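{- Let $\mathcal H\subseteq 2^V$ be a transversal-free hypergraph. Then for every position $x\in\mathbb Z_{\ge0}^V$ and every move $x\to x'$ in $NIM_{\mathcal H}$ we have $f_{\mathcal H}(x)\neq f_{\mathcal H}(x')$.
   Context: Let $V=\{1,\dots,n\}$. A hypergraph is a family $\mathcal H\subseteq 2^V$ with $\mathcal H\neq\emptyset$, $\emptyset\notin\mathcal H$, $V=\bigcup_{H\in\mathcal H}H$. In the game $NIM_{\mathcal H}$, positions are $x\in\mathbb{Z}_{\ge 0}^V$; a move ($H$-move) $x\to x'$ chooses $H\in\mathcal H$ and goes to any $x'\in\mathbb Z_{\ge0}^V$ with $x'_i<x_i$ for $i\in H$ and $x'_i=x_i$ for $i\notin H$. The height $h_{\mathcal H}(x)$ is the maximum number of consecutive moves possible from $x$. With $e$ the all-ones vector, $m(x)=\min_{i}x_i$, $y_{\mathcal H}(x)=h_{\mathcal H}(x-m(x)e)+1$, $v_{\mathcal H}(x)=\binom{y_{\mathcal H}(x)}{2}+\big((m(x)-\binom{y_{\mathcal H}(x)}{2}-1)\bmod y_{\mathcal H}(x)\big)$ (residue in $\{0,\dots,y_{\mathcal H}(x)-1\}$), and $f_{\mathcal H}(x)=h_{\mathcal H}(x)$ if $m(x)\le\binom{y_{\mathcal H}(x)}{2}$, else $f_{\mathcal H}(x)=v_{\mathcal H}(x)$. $\mathcal H$ is transversal-free if for every $H\in\mathcal H$ there exists $H'\in\mathcal H$ with $H\cap H'=\emptyset$. -}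

module Defs where

open import Data.Nat using (ℕ; zero; suc; _+_; _∸_; _≤_; _<_; _⊓_)
open import Data.Nat.DivMod using (_%_)
open import Data.Nat.Combinatorics using (_C_)
open import Data.Fin using (Fin; zero; suc)
open import Data.Fin.Subset using (Subset; _∈_; _∉_; _∩_; Nonempty; Empty)
open import Data.Product using (Σ; ∃; _×_)
open import Relation.Binary.PropositionalEquality using (_≡_)

-- V = Fin n ; a hypergraph is a family of subsets, given as a predicate on Subset n.
Family : ℕ → Set₁
Family n = Subset n → Set

record IsHypergraph {n : ℕ} (ℋ : Family n) : Set where
  field
    nonempty  : ∃ λ H → ℋ H
    noEmpty   : ∀ H → ℋ H → Nonempty H
    covering  : ∀ (i : Fin n) → ∃ λ H → ℋ H × i ∈ H

TransversalFree : {n : ℕ} → Family n → Set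
TransversalFree ℋ = ∀ H → ℋ H → ∃ λ H' → ℋ H' × Empty (H ∩ H')

Pos : ℕ → Set
Pos n = Fin n → ℕ

Move : {n : ℕ} → Family n → Pos n → Pos n → Set
Move {n} ℋ x x' = ∃ λ H → ℋ H
  × (∀ (i : Fin n) → i ∈ H → x' i < x i)
  × (∀ (i : Fin n) → i ∉ H → x' i ≡ x i)

data Play {n : ℕ} (ℋ : Family n) : Pos n → ℕ → Set where
  stop : ∀ {x} → Play ℋ x 0
  step : ∀ {x x' k} → Move ℋ x x' → Play ℋ x' k → Play ℋ x (suc k)

IsHeight : {n : ℕ} → Family n → Pos n → ℕ → Set
IsHeight ℋ x k = Play ℋ x k × (∀ j → Play ℋ x j → j ≤ k)

-- m(x) = min_i x_i  (value 0 for n = 0, which never occurs for a hypergraph)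
minPos : {n : ℕ} → Pos n → ℕ
minPos {zero} x = 0
minPos {suc zero} x = x zero
minPos {suc (suc n)} x = x zero ⊓ minPos {suc n} (λ i → x (suc i))

shift : {n : ℕ} → Pos n → Pos n
shift x i = x i ∸ minPos x

-- IsF ℋ x v  :  f_ℋ(x) = v, where y = h(x - m e) + 1 = suc hy
IsF : {n : ℕ} → Family n → Pos n → ℕ → Set
IsF ℋ x v = Σ ℕ λ hy → IsHeight ℋ (shift x) hy
  × ((minPos x ≤ (suc hy C 2) → IsHeight ℋ x v)
  × ((suc hy C 2) < minPos x →
       v ≡ (suc hy C 2) + ((minPos x ∸ (suc hy C 2) ∸ 1) % suc hy)))

module Submission where

-- Write m = min x, y = h(x - m e) + 1 and c = C(y,2).  Then f(x) is either the
-- height h(x) (when m ≤ c) or the "periodic value" c + ((m - c - 1) mod y),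
-- which lies in [c, c + y) = [C(y,2), C(y+1,2)) and is below m (when c < m).
-- The proof compares the regimes of x and x':
--   * height/height: a move strictly lowers the height;
--   * height/periodic: f(x') < m(x') while h(x) > m(x'), since from x' one can
--     play m(x') moves on any single edge;
--   * periodic/height: f(x) < m(x) ≤ h(x'), since by transversal-freeness some
--     edge is untouched by the move, so m(x) moves on it remain from x';
--   * periodic/periodic: different y give disjoint value windows; for equal y,
--     m(x) = m(x') would make x - m e → x' - m e a move lowering the height, and
--     otherwise 0 < m(x) - m(x') < y, so the two residues mod y differ.
-- The file first proves the arithmetic of periodic values, then facts about
-- minima and plays, and finally the four cases.

open import Defs
open import Data.Nat using (ℕ; zero; suc; pred; _+_; _*_; _∸_; _≤_; _<_; _≤′_; ≤′-refl; ≤′-step; z≤n; s≤s; NonZero; >-nonZero; _≤?_)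
open import Data.Nat.Properties
open import Data.Nat.DivMod using (_%_; _/_; m≡m%n+[m/n]*n; m%n<n; m%n≤m)
open import Data.Nat.Divisibility using (_∣_; n∣m*n; ∣m+n∣m⇒∣n; ∣⇒≤)
open import Data.Nat.Combinatorics using (_C_; nCk+nC[k+1]≡[n+1]C[k+1]; nC1≡n)
open import Data.Fin using (Fin)
open import Data.Fin.Subset using (Subset; _∈_; _∉_)
open import Data.Fin.Subset.Properties using (_∈?_; x∈p∩q⁺)
open import Data.Product using (∃; _×_; _,_; proj₁; proj₂)
open import Data.Sum using (inj₁; inj₂)
open import Relation.Nullary using (yes; no; contradiction)
open import Relation.Binary using (tri<; tri≈; tri>)
open import Relation.Binary.PropositionalEquality using (_≡_; _≢_; refl; sym; trans; cong; subst; module ≡-Reasoning)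

residue-gap : ∀ a d Y .{{_ : NonZero Y}} → 0 < d → d < Y → (a + d) % Y ≢ a % Y
residue-gap a d Y 0<d d<Y same = <⇒≱ d<Y (∣⇒≤ {{>-nonZero 0<d}} Y∣d)
  where
  Y∣m∸m%Y : ∀ m → Y ∣ m ∸ m % Y
  Y∣m∸m%Y m = subst (Y ∣_) (sym (trans (cong (_∸ m % Y) (m≡m%n+[m/n]*n m Y))
                                       (m+n∸m≡n (m % Y) (m / Y * Y))))
                    (n∣m*n (m / Y))
  Y∣d : Y ∣ d
  Y∣d = ∣m+n∣m⇒∣n
    (subst (Y ∣_) (trans (cong ((a + d) ∸_) same) (+-∸-comm d (m%n≤m a Y))) (Y∣m∸m%Y (a + d)))
    (Y∣m∸m%Y a)

triangle-step : ∀ y → suc y C 2 ≡ y C 2 + y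
triangle-step y = begin
  suc y C 2         ≡⟨ nCk+nC[k+1]≡[n+1]C[k+1] y 1 ⟨
  y C 1 + y C 2     ≡⟨ +-comm (y C 1) (y C 2) ⟩
  y C 2 + y C 1     ≡⟨ cong (y C 2 +_) (nC1≡n y) ⟩
  y C 2 + y         ∎
  where open ≡-Reasoning

triangle-mono : ∀ {y y'} → y ≤ y' → y C 2 ≤ y' C 2
triangle-mono y≤y' = go (≤⇒≤′ y≤y')
  where
  go : ∀ {y y'} → y ≤′ y' → y C 2 ≤ y' C 2
  go ≤′-refl = ≤-refl
  go (≤′-step {k} p) = ≤-trans (go p) (≤-trans (m≤m+n (k C 2) k) (≤-reflexive (sym (triangle-step k))))

periodicValue : (hy m : ℕ) → ℕ
periodicValue hy m = suc hy C 2 + ((m ∸ suc hy C 2 ∸ 1) % suc hy)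

periodicValue<min : ∀ hy m → suc hy C 2 < m → periodicValue hy m < m
periodicValue<min hy m c<m = begin-strict
  c + (m ∸ c ∸ 1) % suc hy  ≤⟨ +-monoʳ-≤ c (m%n≤m (m ∸ c ∸ 1) (suc hy)) ⟩
  c + (m ∸ c ∸ 1)           <⟨ +-monoʳ-< c (∸-monoʳ-< (s≤s z≤n) (m<n⇒0<n∸m c<m)) ⟩
  c + (m ∸ c)               ≡⟨ m+[n∸m]≡n (<⇒≤ c<m) ⟩
  m                         ∎
  where
  c = suc hy C 2
  open ≤-Reasoning

periodicValue<next-triangle : ∀ hy m → periodicValue hy m < suc (suc hy) C 2
periodicValue<next-triangle hy m = begin-strict
  suc hy C 2 + (m ∸ suc hy C 2 ∸ 1) % suc hy  <⟨ +-monoʳ-< (suc hy C 2) (m%n<n (m ∸ suc hy C 2 ∸ 1) (suc hy)) ⟩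
  suc hy C 2 + suc hy                         ≡⟨ triangle-step (suc hy) ⟨
  suc (suc hy) C 2                            ∎
  where open ≤-Reasoning

periodicValue-separates : ∀ {hy hy'} m m' → hy < hy' → periodicValue hy m < periodicValue hy' m'
periodicValue-separates {hy} {hy'} m m' hy<hy' = begin-strict
  periodicValue hy m   <⟨ periodicValue<next-triangle hy m ⟩
  suc (suc hy) C 2     ≤⟨ triangle-mono (s≤s hy<hy') ⟩
  suc hy' C 2          ≤⟨ m≤m+n (suc hy' C 2) _ ⟩
  periodicValue hy' m' ∎
  where open ≤-Reasoning

periodicValue-injective-window : ∀ hy {m' m} → suc hy C 2 < m' → m' < m → m ∸ m' ≤ hy →
  periodicValue hy m ≢ periodicValue hy m'
periodicValue-injective-window hy {m'} {m} c<m' m'<m d≤hy same =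
  residue-gap (m' ∸ c ∸ 1) d (suc hy) (m<n⇒0<n∸m m'<m) (s≤s d≤hy)
    (trans (cong (_% suc hy) (sym distance)) (+-cancelˡ-≡ c _ _ same))
  where
  c = suc hy C 2
  d = m ∸ m'
  distance : m ∸ c ∸ 1 ≡ (m' ∸ c ∸ 1) + d
  distance = begin
    m ∸ c ∸ 1               ≡⟨ cong (λ t → t ∸ c ∸ 1) (m+[n∸m]≡n (<⇒≤ m'<m)) ⟨
    (m' + d) ∸ c ∸ 1        ≡⟨ cong (_∸ 1) (+-∸-comm d (<⇒≤ c<m')) ⟩
    ((m' ∸ c) + d) ∸ 1      ≡⟨ +-∸-comm d (m<n⇒0<n∸m c<m') ⟩
    (m' ∸ c ∸ 1) + d        ∎
    where open ≡-Reasoning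

minPos-≤ : ∀ {n} (x : Pos n) i → minPos x ≤ x i
minPos-≤ {suc zero} x Fin.zero = ≤-refl
minPos-≤ {suc (suc n)} x Fin.zero = m⊓n≤m _ _
minPos-≤ {suc (suc n)} x (Fin.suc i) = ≤-trans (m⊓n≤n _ _) (minPos-≤ {suc n} (λ j → x (Fin.suc j)) i)

minPos-mono : ∀ {n} (x z : Pos n) → (∀ i → x i ≤ z i) → minPos x ≤ minPos z
minPos-mono {zero} x z x≤z = z≤n
minPos-mono {suc zero} x z x≤z = x≤z Fin.zero
minPos-mono {suc (suc n)} x z x≤z =
  ⊓-mono-≤ (x≤z Fin.zero) (minPos-mono {suc n} (λ j → x (Fin.suc j)) (λ j → z (Fin.suc j)) (λ j → x≤z (Fin.suc j)))

move-minPos-≤ : ∀ {n} {ℋ : Family n} {x x'} → Move ℋ x x' → minPos x' ≤ minPos x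
move-minPos-≤ {x = x} {x'} (H , _ , down , same) = minPos-mono x' x x'≤x
  where
  x'≤x : ∀ i → x' i ≤ x i
  x'≤x i with i ∈? H
  ... | yes i∈H = <⇒≤ (down i i∈H)
  ... | no i∉H = ≤-reflexive (same i i∉H)

shift-move : ∀ {n} {ℋ : Family n} {x x'} → minPos x' ≡ minPos x → Move ℋ x x' → Move ℋ (shift x) (shift x')
shift-move {x = x} {x'} m'≡m (H , H∈ℋ , down , same) = H , H∈ℋ , shifted-down , shifted-same
  where
  shifted-down : ∀ i → i ∈ H → x' i ∸ minPos x' < x i ∸ minPos x
  shifted-down i i∈H rewrite m'≡m = ∸-monoˡ-< (down i i∈H) (subst (_≤ x' i) m'≡m (minPos-≤ x' i))
  shifted-same : ∀ i → i ∉ H → x' i ∸ minPos x' ≡ x i ∸ minPos x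
  shifted-same i i∉H rewrite m'≡m | same i i∉H = refl

untouched-edge : ∀ {n} {ℋ : Family n} {x x'} → TransversalFree ℋ → Move ℋ x x' →
  ∃ λ H' → ℋ H' × (∀ i → i ∈ H' → x' i ≡ x i)
untouched-edge tf (H , H∈ℋ , _ , same) with tf H H∈ℋ
... | H' , H'∈ℋ , disjoint = H' , H'∈ℋ , λ i i∈H' → same i (λ i∈H → disjoint (i , x∈p∩q⁺ (i∈H , i∈H')))

lowerOn : ∀ {n} → Subset n → Pos n → Pos n
lowerOn H z i with i ∈? H
... | yes _ = pred (z i)
... | no _ = z i

edge-play : ∀ {n} {ℋ : Family n} H → ℋ H → ∀ k (z : Pos n) → (∀ i → i ∈ H → k ≤ z i) → Play ℋ z k
edge-play H H∈ℋ zero z _ = stop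
edge-play H H∈ℋ (suc k) z large =
  step (H , H∈ℋ , lowered , kept) (edge-play H H∈ℋ k (lowerOn H z) still-large)
  where
  lowered : ∀ i → i ∈ H → lowerOn H z i < z i
  lowered i i∈H with i ∈? H
  ... | yes _ = ≤-reflexive (suc-pred (z i) {{>-nonZero (≤-trans (s≤s z≤n) (large i i∈H))}})
  ... | no i∉H = contradiction i∈H i∉H
  kept : ∀ i → i ∉ H → lowerOn H z i ≡ z i
  kept i i∉H with i ∈? H
  ... | yes i∈H = contradiction i∈H i∉H
  ... | no _ = refl
  still-large : ∀ i → i ∈ H → k ≤ lowerOn H z i
  still-large i i∈H with i ∈? H
  ... | yes _ = pred-mono-≤ (large i i∈H)
  ... | no i∉H = contradiction i∈H i∉H

min-play : ∀ {n} {ℋ : Family n} → IsHypergraph ℋ → (z : Pos n) → Play ℋ z (minPos z)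
min-play hg z with IsHypergraph.nonempty hg
... | E , E∈ℋ = edge-play E E∈ℋ (minPos z) z (λ i _ → minPos-≤ z i)

-- After a move x → x', still m(x) moves can be played, on an untouched edge.
min-play-after-move : ∀ {n} {ℋ : Family n} {x x'} → TransversalFree ℋ → Move ℋ x x' → Play ℋ x' (minPos x)
min-play-after-move {x = x} tf mv with untouched-edge tf mv
... | H' , H'∈ℋ , same = edge-play H' H'∈ℋ (minPos x) _ (λ i i∈H' → subst (minPos x ≤_) (sym (same i i∈H')) (minPos-≤ x i))

shifted-play-after-move : ∀ {n} {ℋ : Family n} {x x'} → TransversalFree ℋ → Move ℋ x x' →
  Play ℋ (shift x') (minPos x ∸ minPos x')
shifted-play-after-move {x = x} {x'} tf mv with untouched-edge tf mv
... | H' , H'∈ℋ , same = edge-play H' H'∈ℋ (minPos x ∸ minPos x') (shift x')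
  (λ i i∈H' → ∸-monoˡ-≤ (minPos x') (subst (minPos x ≤_) (sym (same i i∈H')) (minPos-≤ x i)))

height-after-move : ∀ {n} {ℋ : Family n} {x x' k j} → IsHeight ℋ x k → Move ℋ x x' → Play ℋ x' j → j < k
height-after-move (_ , maximal) mv play = maximal _ (step mv play)

data Regime {n} (ℋ : Family n) (x : Pos n) (a : ℕ) : Set where
  byHeight : IsHeight ℋ x a → Regime ℋ x a
  periodic : ∀ hy → IsHeight ℋ (shift x) hy → suc hy C 2 < minPos x →
             a ≡ periodicValue hy (minPos x) → Regime ℋ x a

regime : ∀ {n} {ℋ : Family n} {x a} → IsF ℋ x a → Regime ℋ x a
regime {x = x} (hy , shifted , low , high) with minPos x ≤? suc hy C 2
... | yes m≤c = byHeight (low m≤c)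
... | no m≰c = periodic hy shifted (≰⇒> m≰c) (high (≰⇒> m≰c))

-- Both ends in the periodic regime: different y are separated by their windows;
-- for equal y the minimum must drop (else the height of x - m e drops), by less than y.
periodic-periodic : ∀ {n} {ℋ : Family n} {x x' hy hy'} → TransversalFree ℋ → Move ℋ x x' →
  IsHeight ℋ (shift x) hy → IsHeight ℋ (shift x') hy' → suc hy' C 2 < minPos x' →
  periodicValue hy (minPos x) ≢ periodicValue hy' (minPos x')
periodic-periodic {hy = hy} {hy'} tf mv h h' c<m' with <-cmp hy hy'
... | tri< hy<hy' _ _ = <⇒≢ (periodicValue-separates _ _ hy<hy')
... | tri> _ _ hy>hy' = >⇒≢ (periodicValue-separates _ _ hy>hy')
... | tri≈ _ refl _ with m≤n⇒m<n∨m≡n (move-minPos-≤ mv)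
...   | inj₂ m'≡m = contradiction (height-after-move h (shift-move m'≡m mv) (proj₁ h')) (<-irrefl refl)
...   | inj₁ m'<m = periodicValue-injective-window hy c<m' m'<m
                      (proj₂ h' _ (shifted-play-after-move tf mv))

lemma3p6 : (n : ℕ) (ℋ : Family n) → IsHypergraph ℋ → TransversalFree ℋ →
    ∀ (x x' : Pos n) → Move ℋ x x' →
    ∀ (a b : ℕ) → IsF ℋ x a → IsF ℋ x' b → a ≢ b
lemma3p6 n ℋ hg tf x x' mv a b fx fx' = distinct (regime fx) (regime fx')
  where
  distinct : Regime ℋ x a → Regime ℋ x' b → a ≢ b
  distinct (byHeight h) (byHeight (play' , _)) = >⇒≢ (height-after-move h mv play')
  distinct (byHeight h) (periodic hy' _ c<m' refl) =
    >⇒≢ (<-trans (periodicValue<min hy' _ c<m') (height-after-move h mv (min-play hg x')))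
  distinct (periodic hy _ c<m refl) (byHeight (_ , maximal)) =
    <⇒≢ (<-≤-trans (periodicValue<min hy _ c<m) (maximal _ (min-play-after-move tf mv)))
  distinct (periodic hy h _ refl) (periodic hy' h' c<m' refl) = periodic-periodic tf mv h h' c<m'
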